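{- Let $n \ge 2$ and let $l$ be a non-decreasing integer-valued sequence with $l(1) = 2^{n-1}$ and $l(k+1)-l(k) \in \{\sum_{i=1}^{b}2^{n-i} : 1 \le b \le n\}$ for all $k$. For each $k$ let $I(l(k))$ be the set of integers in $[l(k)-(2^{n-1}-1), l(k)+(2^{n-1}-1)]$. Then $\bigcup_{k=1}^\infty I(l(k))$ is the set of all positive integers. -}

module Defs where

open import Data.Nat using (ℕ; zero; suc; _+_; _∸_; _^_)
open import Data.Integer using (ℤ; +_; _-_; _≤_) renaming (_+_ to _+ℤ_)
open import Data.Product using (_×_)

partialSum : ℕ → ℕ → ℕ
partialSum n zero    = 0
partialSum n (suc b) = partialSum n b + 2 ^ (n ∸ suc b)

InI : ℕ → ℤ → ℤ → Set
InI n c m = (c - ((+ (2 ^ (n ∸ 1))) - (+ 1)) ≤ m) × (m ≤ c +ℤ ((+ (2 ^ (n ∸ 1))) - (+ 1)))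

module Submission where

-- Write h = 2^(n-1) - 1, so that I(c) is the window of radius h
-- around c.  The admissible increments partialSum n b (1 ≤ b ≤ n) equal
-- 2^n - 2^(n-b), hence lie between 1 and 2^n - 1 = 2h + 1.  So the centres
-- l(1) < l(2) < ... strictly increase, and consecutive windows of length
-- 2h + 1 overlap or touch: there is never a gap between them.

open import Defs
open import Data.Nat using (ℕ; _∸_; _^_)
open import Data.Integer using (ℤ; +_; _-_; _≤_; _<_)
open import Data.Product using (_×_; Σ; ∃; ∃-syntax)
open import Relation.Binary.PropositionalEquality using (_≡_)

open import Data.Nat using (suc; zero; z≤n; s≤s; s≤s⁻¹; pred)
  renaming (_≤_ to _≤ℕ_; _<_ to _<ℕ_; _+_ to _+ℕ_)
import Data.Nat.Properties as ℕP
open import Data.Integer using (_+_; -_; ∣_∣; -[1+_]; +≤+; -≤+)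
import Data.Integer.Properties as ℤP
open import Data.Integer.Tactic.RingSolver using (solve-∀)
open import Data.Product using (_,_; proj₁; proj₂)
open import Relation.Binary.PropositionalEquality using (refl; sym; trans; cong; subst; module ≡-Reasoning)
open import Relation.Nullary using (yes; no)

-- The integers m within distance r of the centre c.  Note that
-- InI n c m is by definition Window (+ 2^(n-1) - + 1) c m.
Window : ℤ → ℤ → ℤ → Set
Window r c m = (c - r ≤ m) × (m ≤ c + r)

i≤+∣i∣ : ∀ i → i ≤ + ∣ i ∣
i≤+∣i∣ (+ n)    = ℤP.≤-refl
i≤+∣i∣ -[1+ n ] = -≤+

module Chain (h : ℕ) (c : ℕ → ℤ)
  (steps : ∀ k → ∃[ d ] ((c (suc k) ≡ c k + + d) × (1 ≤ℕ d) × (d ≤ℕ suc (h +ℕ h))))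
  where

  open ℤP.≤-Reasoning

  climbs : ∀ k → c 0 + + k ≤ c k
  climbs zero = ℤP.≤-reflexive (ℤP.+-identityʳ (c 0))
  climbs (suc k) with steps k
  ... | d , c[1+k] , 1≤d , _ = begin
    c 0 + + suc k      ≡⟨ cong (λ z → c 0 + z) (ℤP.pos-+ 1 k) ⟩
    c 0 + (+ 1 + + k)  ≡⟨ reassoc (c 0) (+ k) ⟩
    (c 0 + + k) + + 1  ≤⟨ ℤP.+-mono-≤ (climbs k) (+≤+ 1≤d) ⟩
    c k + + d          ≡⟨ sym c[1+k] ⟩
    c (suc k)          ∎
    where
    reassoc : ∀ x y → x + (+ 1 + y) ≡ (x + y) + + 1
    reassoc = solve-∀

  above-start : ∀ k → c 0 ≤ c k
  above-start k = ℤP.≤-trans (ℤP.i≤i+j (c 0) (+ k)) (climbs k)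

  unbounded : ∀ m → m ≤ c ∣ m - c 0 ∣
  unbounded m = begin
    m                      ≡⟨ split m (c 0) ⟩
    c 0 + (m - c 0)        ≤⟨ ℤP.+-monoʳ-≤ (c 0) (i≤+∣i∣ (m - c 0)) ⟩
    c 0 + + ∣ m - c 0 ∣    ≤⟨ climbs ∣ m - c 0 ∣ ⟩
    c ∣ m - c 0 ∣          ∎
    where
    split : ∀ x y → x ≡ y + (x - y)
    split = solve-∀

  no-gap : ∀ k → c (suc k) - + h ≤ + 1 + (c k + + h)
  no-gap k with steps k
  ... | d , c[1+k] , _ , d≤2h+1 = begin
    c (suc k) - + h                   ≡⟨ cong (_- + h) c[1+k] ⟩
    c k + + d - + h                   ≤⟨ ℤP.+-monoˡ-≤ (- + h) (ℤP.+-monoʳ-≤ (c k) (+≤+ d≤2h+1)) ⟩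
    c k + + suc (h +ℕ h) - + h       ≡⟨ cong (λ s → c k + s - + h) 2h+1≡ ⟩
    c k + (+ 1 + (+ h + + h)) - + h   ≡⟨ cancel (c k) (+ h) ⟩
    + 1 + (c k + + h)                 ∎
    where
    2h+1≡ : + suc (h +ℕ h) ≡ + 1 + (+ h + + h)
    2h+1≡ = trans (ℤP.pos-+ 1 (h +ℕ h)) (cong (λ z → + 1 + z) (ℤP.pos-+ h h))
    cancel : ∀ x y → x + (+ 1 + (y + y)) - y ≡ + 1 + (x + y)
    cancel = solve-∀

  -- Every integer between c 0 - h and c j + h lies in one of the windows
  -- around c 0, ..., c j: either below the end of the window around
  -- c (j - 1), or past it and hence (no gap) inside the window around c j.
  covered-upto : ∀ j m → c 0 - + h ≤ m → m ≤ c j + + h → ∃[ k ] Window (+ h) (c k) m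
  covered-upto zero    m lo hi = 0 , lo , hi
  covered-upto (suc j) m lo hi with m ℤP.≤? c j + + h
  ... | yes m≤end = covered-upto j m lo m≤end
  ... | no  m≰end = suc j , ℤP.≤-trans (no-gap j) (ℤP.i<j⇒suc[i]≤j (ℤP.≰⇒> m≰end)) , hi

  windows-cover : ∀ m → ((∃[ k ] Window (+ h) (c k) m) → c 0 - + h ≤ m)
                      × (c 0 - + h ≤ m → ∃[ k ] Window (+ h) (c k) m)
  windows-cover m = inside⇒above , above⇒inside
    where
    inside⇒above : (∃[ k ] Window (+ h) (c k) m) → c 0 - + h ≤ m
    inside⇒above (k , lo , _) = ℤP.≤-trans (ℤP.+-monoˡ-≤ _ (above-start k)) lo

    above⇒inside : c 0 - + h ≤ m → ∃[ k ] Window (+ h) (c k) m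
    above⇒inside lo = covered-upto ∣ m - c 0 ∣ m lo
      (ℤP.≤-trans (unbounded m) (ℤP.i≤i+j (c ∣ m - c 0 ∣) (+ h)))

∸-peel : ∀ n b → suc b ≤ℕ n → n ∸ b ≡ suc (n ∸ suc b)
∸-peel (suc n) zero    _         = refl
∸-peel (suc n) (suc b) (s≤s b<n) = ∸-peel n b b<n

partialSum-complement : ∀ n b → b ≤ℕ n → partialSum n b +ℕ 2 ^ (n ∸ b) ≡ 2 ^ n
partialSum-complement n zero    _   = refl
partialSum-complement n (suc b) b<n = begin
  partialSum n b +ℕ x +ℕ x      ≡⟨ ℕP.+-assoc (partialSum n b) x x ⟩
  partialSum n b +ℕ (x +ℕ x)    ≡⟨ cong (partialSum n b +ℕ_) (sym double) ⟩
  partialSum n b +ℕ 2 ^ (n ∸ b)  ≡⟨ partialSum-complement n b (ℕP.<⇒≤ b<n) ⟩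
  2 ^ n                           ∎
  where
  open ≡-Reasoning
  x : ℕ
  x = 2 ^ (n ∸ suc b)
  double : 2 ^ (n ∸ b) ≡ x +ℕ x
  double rewrite ∸-peel n b b<n = cong (x +ℕ_) (ℕP.+-identityʳ x)

partialSum-positive : ∀ n b → 1 ≤ℕ b → 1 ≤ℕ partialSum n b
partialSum-positive n (suc b) _ =
  ℕP.≤-trans (ℕP.m^n>0 2 (n ∸ suc b)) (ℕP.m≤n+m _ (partialSum n b))

partialSum<2^n : ∀ n b → b ≤ℕ n → partialSum n b <ℕ 2 ^ n
partialSum<2^n n b b≤n = subst (partialSum n b <ℕ_) (partialSum-complement n b b≤n)
  (ℕP.m<m+n (partialSum n b) (ℕP.m^n>0 2 (n ∸ b)))

-- Windows for exponent n + 1 have radius h = 2^n - 1; then 2^n = h + 1 and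
-- 2^(n+1) = 2 (h + 1), so a number below 2^(n+1) is at most 2h + 1.
module Radius (n : ℕ) where

  h : ℕ
  h = pred (2 ^ n)

  2^n≡1+h : 2 ^ n ≡ suc h
  2^n≡1+h = sym (ℕP.suc-pred (2 ^ n) {{ℕP.m^n≢0 2 n}})

  radius≡ : + (2 ^ n) - + 1 ≡ + h
  radius≡ = trans (cong (λ p → + p - + 1) 2^n≡1+h) (drop-one (+ h))
    where
    drop-one : ∀ x → (+ 1 + x) - + 1 ≡ x
    drop-one = solve-∀

  below-2^[1+n] : ∀ d → d <ℕ 2 ^ suc n → d ≤ℕ suc (h +ℕ h)
  below-2^[1+n] d d<2^[1+n] = subst (d ≤ℕ_) (ℕP.+-suc h h) (s≤s⁻¹ d<2[1+h])
    where
    2^[1+n]≡ : 2 ^ suc n ≡ suc h +ℕ suc h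
    2^[1+n]≡ = trans (cong (2 ^ n +ℕ_) (ℕP.+-identityʳ (2 ^ n)))
                     (cong (λ p → p +ℕ p) 2^n≡1+h)
    d<2[1+h] : suc d ≤ℕ suc (h +ℕ suc h)
    d<2[1+h] = subst (d <ℕ_) 2^[1+n]≡ d<2^[1+n]

  increment-bounds : ∀ b → 1 ≤ℕ b → b ≤ℕ suc n
                   → (1 ≤ℕ partialSum (suc n) b) × (partialSum (suc n) b ≤ℕ suc (h +ℕ h))
  increment-bounds b 1≤b b≤1+n =
    partialSum-positive (suc n) b 1≤b , below-2^[1+n] _ (partialSum<2^n (suc n) b b≤1+n)

difference⇒step : ∀ {x y d} → x - y ≡ + d → x ≡ y + + d
difference⇒step {x} {y} diff = trans (split x y) (cong (λ z → y + z) diff)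
  where
  split : ∀ x y → x ≡ y + (x - y)
  split = solve-∀

first-window-start : ∀ h → + suc h - + h ≡ + 1
first-window-start h = cancel (+ h)
  where
  cancel : ∀ x → + 1 + x - x ≡ + 1
  cancel = solve-∀

lemma2p14 : (n : ℕ) → 2 Data.Nat.≤ n → (l : ℕ → ℤ)
    → (∀ k → 1 Data.Nat.≤ k → l k ≤ l (ℕ.suc k))
    → l 1 ≡ (+ (2 ^ (n ∸ 1)))
    → (∀ k → 1 Data.Nat.≤ k → ∃[ b ] ((1 Data.Nat.≤ b) × (b Data.Nat.≤ n) × (l (ℕ.suc k) - l k ≡ (+ (partialSum n b)))))
    → ∀ (m : ℤ) → ((∃[ k ] ((1 Data.Nat.≤ k) × InI n (l k) m)) → + 0 < m)
    × (+ 0 < m → ∃[ k ] ((1 Data.Nat.≤ k) × InI n (l k) m))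
-- After rewriting the radius 2^n - 1 of InI as + h, both directions follow
-- from windows-cover for the chain c k = l (k + 1), shifting indices by one.
lemma2p14 (suc n) (s≤s _) l _ l1 increments m =
  subst (λ r → ((∃[ k ] ((1 ≤ℕ k) × Window r (l k) m)) → + 0 < m)
             × (+ 0 < m → ∃[ k ] ((1 ≤ℕ k) × Window r (l k) m)))
        (sym radius≡)
        (inside⇒positive , positive⇒inside)
  where
  open Radius n

  c : ℕ → ℤ
  c k = l (suc k)

  steps : ∀ k → ∃[ d ] ((c (suc k) ≡ c k + + d) × (1 ≤ℕ d) × (d ≤ℕ suc (h +ℕ h)))
  steps k with increments (suc k) (s≤s z≤n)
  ... | b , 1≤b , b≤n , diff = partialSum (suc n) b , difference⇒step diff , increment-bounds b 1≤b b≤n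

  open Chain h c steps using (windows-cover)

  start : c 0 - + h ≡ + 1
  start = trans (cong (_- + h) (trans l1 (cong +_ 2^n≡1+h))) (first-window-start h)

  inside⇒positive : (∃[ k ] ((1 ≤ℕ k) × Window (+ h) (l k) m)) → + 0 < m
  inside⇒positive (zero  , ()  , _)
  inside⇒positive (suc k , _ , w) =
    ℤP.suc[i]≤j⇒i<j (subst (_≤ m) start (proj₁ (windows-cover m) (k , w)))

  positive⇒inside : + 0 < m → ∃[ k ] ((1 ≤ℕ k) × Window (+ h) (l k) m)
  positive⇒inside 0<m with proj₂ (windows-cover m) (subst (_≤ m) (sym start) (ℤP.i<j⇒suc[i]≤j 0<m))
  ... | k , w = suc k , s≤s z≤n , w
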